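{- Let $1\le r\le n$ and $1\le d\le n$ be integers. Then $S(n,d,r)$ is a distributive sublattice of $S(n,r)$, i.e. it is closed under the componentwise minimum and componentwise maximum of strings.
   Context: Let $A(n,r)$ be an alphabet of $n+1$ formal symbols $\tilde 1,\dots,\tilde r,\ 0^\S,\ \bar 1,\dots,\overline{n-r}$, totally ordered by $\overline{n-r}\prec\cdots\prec\bar1\prec 0^\S\prec\tilde1\prec\cdots\prec\tilde r$. Let $S(n,r)$ be the set of strings $w=i_1\cdots i_r\,|\,j_1\cdots j_{n-r}$ with $i_k\in\{\tilde1,\dots,\tilde r,0^\S\}$, $j_k\in\{0^\S,\bar1,\dots,\overline{n-r}\}$ such that for some $0\le p\le r$, $1\le q\le n-r+1$: $i_1\succ\cdots\succ i_p\succ 0^\S=i_{p+1}=\cdots=i_r$ and $j_1=\cdots=j_{q-1}=0^\S\succ j_q\succ\cdots\succ j_{n-r}$. $S(n,r)$ is ordered componentwise by $\preceq$ (written $\sqsubseteq$); it is a lattice whose meet and join are the componentwise minimum and maximum. $S(n,d,r)$ denotes the set of strings of $S(n,r)$ containing exactly $d$ symbols different from $0^\S$. -}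

module Defs where

open import Data.Nat using (ℕ; zero; suc; _+_; _∸_; _<_; _≤_)
open import Data.Fin using (Fin; toℕ)
import Data.Fin as F
open import Data.Integer as ℤ using (ℤ; +_; -[1+_])
import Data.Integer.Properties as ℤP
open import Data.Product using (Σ; _×_; ∃)
open import Relation.Binary.PropositionalEquality using (_≡_)
open import Relation.Nullary using (yes; no)

-- The alphabet A(n,r): tilde i stands for the symbol  ~(i+1)  (i : Fin r),
-- zer stands for 0^§, bar j stands for  ‾(j+1)  (j : Fin (n ∸ r)).
data Sym (n r : ℕ) : Set where
  tilde : Fin r → Sym n r
  zer   : Sym n r
  bar   : Fin (n ∸ r) → Sym n r

-- The total order  ‾(n-r) ≺ ... ≺ ‾1 ≺ 0^§ ≺ ~1 ≺ ... ≺ ~r  is realised by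
-- the injective rank function into ℤ.
rank : ∀ {n r} → Sym n r → ℤ
rank (tilde i) = + suc (toℕ i)
rank zer       = + 0
rank (bar j)   = -[1+ toℕ j ]

_⪯_ : ∀ {n r} → Sym n r → Sym n r → Set
a ⪯ b = rank a ℤ.≤ rank b

_≺_ : ∀ {n r} → Sym n r → Sym n r → Set
a ≺ b = rank a ℤ.< rank b

minS : ∀ {n r} → Sym n r → Sym n r → Sym n r
minS a b with rank a ℤ.≤? rank b
... | yes _ = a
... | no  _ = b

maxS : ∀ {n r} → Sym n r → Sym n r → Sym n r
maxS a b with rank a ℤ.≤? rank b
... | yes _ = b
... | no  _ = a

-- A string  i_1 ... i_r | j_1 ... j_{n-r}  (positions are 0-based Fin indices).
record Str (n r : ℕ) : Set where
  constructor _∣_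
  field
    left  : Fin r → Sym n r
    right : Fin (n ∸ r) → Sym n r
open Str public

IsTilde : ∀ {n r} → Sym n r → Set
IsTilde {n} {r} a = Σ (Fin r) λ i → a ≡ tilde i

IsBar : ∀ {n r} → Sym n r → Set
IsBar {n} {r} a = Σ (Fin (n ∸ r)) λ j → a ≡ bar j

LeftOK : ∀ {n r} → (Fin r → Sym n r) → Set
LeftOK {n} {r} l = Σ ℕ λ p → p ≤ r ×
  ((k : Fin r) → (toℕ k < p → IsTilde (l k)) × (p ≤ toℕ k → l k ≡ zer)) ×
  ((k k' : Fin r) → toℕ k < toℕ k' → toℕ k' < p → l k' ≺ l k)

-- Right part: for some 1 ≤ q ≤ n-r+1, j_1 = ... = j_{q-1} = 0^§ ≻ j_q ≻ ... ≻ j_{n-r},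
-- with all j_k ∈ {0^§, ‾1..‾(n-r)}.  Here q' = q - 1 ∈ [0, n-r].
RightOK : ∀ {n r} → (Fin (n ∸ r) → Sym n r) → Set
RightOK {n} {r} g = Σ ℕ λ q' → q' ≤ n ∸ r ×
  ((k : Fin (n ∸ r)) → (toℕ k < q' → g k ≡ zer) × (q' ≤ toℕ k → IsBar (g k))) ×
  ((k k' : Fin (n ∸ r)) → q' ≤ toℕ k → toℕ k < toℕ k' → g k' ≺ g k)

InS : ∀ {n r} → Str n r → Set
InS w = LeftOK (left w) × RightOK (right w)

nzSym : ∀ {n r} → Sym n r → ℕ
nzSym zer = 0
nzSym (tilde _) = 1
nzSym (bar _) = 1

countNZ : ∀ {n r} (m : ℕ) → (Fin m → Sym n r) → ℕ
countNZ zero    f = 0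
countNZ (suc m) f = nzSym (f F.zero) + countNZ m (λ k → f (F.suc k))

nonZeros : ∀ {n r} → Str n r → ℕ
nonZeros {n} {r} w = countNZ r (left w) + countNZ (n ∸ r) (right w)

InSd : ∀ {n r} → ℕ → Str n r → Set
InSd d w = InS w × nonZeros w ≡ d

_⊓_ : ∀ {n r} → Str n r → Str n r → Str n r
w ⊓ v = (λ k → minS (left w k) (left v k)) ∣ (λ k → minS (right w k) (right v k))

_⊔_ : ∀ {n r} → Str n r → Str n r → Str n r
w ⊔ v = (λ k → maxS (left w k) (left v k)) ∣ (λ k → maxS (right w k) (right v k))

-- Each side of a string in S(n,r) is described by one cut point: the left part is
-- p tildes in strictly decreasing order followed by zeros, the right part is zeros
-- before position q followed by strictly decreasing bars, so with m = n − r the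
-- string has p + (m ∸ q) nonzero symbols.  The componentwise min (max) of two such
-- strings has the same form with cut points p ⊓ p', q ⊓ q' (p ⊔ p', q ⊔ q').  Having
-- d nonzero symbols means p + m ≡ d + q, and since + distributes over ⊓ and ⊔ this
-- relation passes to the new cut points.
module Submission where

open import Defs
open import Algebra.Definitions using (Selective; _DistributesOverˡ_; _DistributesOverʳ_)
open import Data.Empty using (⊥-elim)
open import Data.Fin using (Fin; toℕ)
import Data.Fin as F
import Data.Fin.Properties as FP
import Data.Integer as ℤ
import Data.Integer.Properties as ℤP
open import Data.Nat as ℕ using (ℕ; zero; suc; _+_; _∸_; _≤_; _<_; z≤n; s≤s; _<?_)
import Data.Nat.Properties as ℕP
open import Data.Product using (_×_; _,_; proj₁; proj₂)
open import Data.Sum as Sum using (_⊎_; inj₁; inj₂; [_,_]′)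
open import Relation.Binary.PropositionalEquality
open import Relation.Nullary using (yes; no)

module _ {a} {A : Set a} {_∙_ : A → A → A} (sel : Selective _≡_ _∙_) where

  sel-pres : ∀ {ℓ} (P : A → Set ℓ) {x y} → P x → P y → P (x ∙ y)
  sel-pres P {x} {y} px py =
    [ (λ x∙y≡x → subst P (sym x∙y≡x) px) , (λ x∙y≡y → subst P (sym x∙y≡y) py) ]′ (sel x y)

  sel-reflect : ∀ {ℓ} (P : A → Set ℓ) {x y} → P (x ∙ y) → P x ⊎ P y
  sel-reflect P {x} {y} p = Sum.map (λ x∙y≡x → subst P x∙y≡x p) (λ x∙y≡y → subst P x∙y≡y p) (sel x y)

+-∸-+ : ∀ p {m q} → q ≤ m → p + (m ∸ q) + q ≡ p + m
+-∸-+ p {m} {q} q≤m = trans (ℕP.+-assoc p (m ∸ q) q) (cong (p +_) (ℕP.m∸n+n≡m q≤m))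

level-closed : ∀ {_∙_ : ℕ → ℕ → ℕ} →
  _DistributesOverˡ_ _≡_ _+_ _∙_ → _DistributesOverʳ_ _≡_ _+_ _∙_ →
  ∀ {m d p p' q q'} → q ≤ m → q' ≤ m → q ∙ q' ≤ m →
  p + (m ∸ q) ≡ d → p' + (m ∸ q') ≡ d → (p ∙ p') + (m ∸ (q ∙ q')) ≡ d
level-closed {_∙_} distˡ distʳ {m} {d} {p} {p'} {q} {q'} q≤m q'≤m q∙q'≤m eq eq' =
  ℕP.+-cancelʳ-≡ (q ∙ q') _ d (begin
    (p ∙ p') + (m ∸ (q ∙ q')) + (q ∙ q') ≡⟨ +-∸-+ (p ∙ p') q∙q'≤m ⟩
    (p ∙ p') + m                         ≡⟨ distʳ m p p' ⟩
    (p + m) ∙ (p' + m)                   ≡⟨ cong₂ _∙_ (balanced q≤m eq) (balanced q'≤m eq') ⟩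
    (d + q) ∙ (d + q')                   ≡⟨ distˡ d q q' ⟨
    d + (q ∙ q')                         ∎)
  where
  open ≡-Reasoning
  balanced : ∀ {p q} → q ≤ m → p + (m ∸ q) ≡ d → p + m ≡ d + q
  balanced {p} {q} q≤m eq = trans (sym (+-∸-+ p q≤m)) (cong (_+ q) eq)

module _ {n r : ℕ} where

  minS-sel : Selective _≡_ (minS {n} {r})
  minS-sel a b with rank a ℤ.≤? rank b
  ... | yes _ = inj₁ refl
  ... | no  _ = inj₂ refl

  maxS-sel : Selective _≡_ (maxS {n} {r})
  maxS-sel a b with rank a ℤ.≤? rank b
  ... | yes _ = inj₂ refl
  ... | no  _ = inj₁ refl

  minS-⪯ˡ : (a b : Sym n r) → minS a b ⪯ a
  minS-⪯ˡ a b with rank a ℤ.≤? rank b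
  ... | yes _   = ℤP.≤-refl
  ... | no  a≰b = ℤP.<⇒≤ (ℤP.≰⇒> a≰b)

  minS-⪯ʳ : (a b : Sym n r) → minS a b ⪯ b
  minS-⪯ʳ a b with rank a ℤ.≤? rank b
  ... | yes a≤b = a≤b
  ... | no  _   = ℤP.≤-refl

  ⪯-maxSˡ : (a b : Sym n r) → a ⪯ maxS a b
  ⪯-maxSˡ a b with rank a ℤ.≤? rank b
  ... | yes a≤b = a≤b
  ... | no  _   = ℤP.≤-refl

  ⪯-maxSʳ : (a b : Sym n r) → b ⪯ maxS a b
  ⪯-maxSʳ a b with rank a ℤ.≤? rank b
  ... | yes _   = ℤP.≤-refl
  ... | no  a≰b = ℤP.<⇒≤ (ℤP.≰⇒> a≰b)

  zer-antisym : {a : Sym n r} → a ⪯ zer → zer ⪯ a → a ≡ zer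
  zer-antisym {tilde _} (ℤ.+≤+ ()) _
  zer-antisym {zer}     _          _ = refl
  zer-antisym {bar _}   _          ()

  zer≺⇒tilde : {a : Sym n r} → zer ≺ a → IsTilde a
  zer≺⇒tilde {tilde i} _ = i , refl
  zer≺⇒tilde {zer}     (ℤ.+<+ ())
  zer≺⇒tilde {bar _}   ()

  tilde⇒zer≺ : {a : Sym n r} → IsTilde a → zer ≺ a
  tilde⇒zer≺ (_ , refl) = ℤ.+<+ (s≤s z≤n)

  ≺zer⇒bar : {a : Sym n r} → a ≺ zer → IsBar a
  ≺zer⇒bar {tilde _} (ℤ.+<+ ())
  ≺zer⇒bar {zer}   (ℤ.+<+ ())
  ≺zer⇒bar {bar j} _ = j , refl

  bar⇒≺zer : {a : Sym n r} → IsBar a → a ≺ zer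
  bar⇒≺zer (_ , refl) = ℤ.-<+

  nzSym-tilde : {a : Sym n r} → IsTilde a → nzSym a ≡ 1
  nzSym-tilde (_ , refl) = refl

  nzSym-bar : {a : Sym n r} → IsBar a → nzSym a ≡ 1
  nzSym-bar (_ , refl) = refl

  minS-⪯-zer : {a b : Sym n r} → a ≡ zer ⊎ b ≡ zer → minS a b ⪯ zer
  minS-⪯-zer {b = b} (inj₁ refl) = minS-⪯ˡ zer b
  minS-⪯-zer {a = a} (inj₂ refl) = minS-⪯ʳ a zer

  zer-⪯-maxS : {a b : Sym n r} → a ≡ zer ⊎ b ≡ zer → zer ⪯ maxS a b
  zer-⪯-maxS {b = b} (inj₁ refl) = ⪯-maxSˡ zer b
  zer-⪯-maxS {a = a} (inj₂ refl) = ⪯-maxSʳ a zer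

  maxS-tilde : {a b : Sym n r} → IsTilde a ⊎ IsTilde b → IsTilde (maxS a b)
  maxS-tilde {a} {b} (inj₁ ta) = zer≺⇒tilde (ℤP.<-≤-trans (tilde⇒zer≺ ta) (⪯-maxSˡ a b))
  maxS-tilde {a} {b} (inj₂ tb) = zer≺⇒tilde (ℤP.<-≤-trans (tilde⇒zer≺ tb) (⪯-maxSʳ a b))

  minS-bar : {a b : Sym n r} → IsBar a ⊎ IsBar b → IsBar (minS a b)
  minS-bar {a} {b} (inj₁ ba) = ≺zer⇒bar (ℤP.≤-<-trans (minS-⪯ˡ a b) (bar⇒≺zer ba))
  minS-bar {a} {b} (inj₂ bb) = ≺zer⇒bar (ℤP.≤-<-trans (minS-⪯ʳ a b) (bar⇒≺zer bb))

  left-nonneg : {l : Fin r → Sym n r} → LeftOK l → ∀ k → zer ⪯ l k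
  left-nonneg (p , _ , shape , _) k with toℕ k <? p
  ... | yes k<p = ℤP.<⇒≤ (tilde⇒zer≺ (proj₁ (shape k) k<p))
  ... | no  k≮p = ℤP.≤-reflexive (cong rank (sym (proj₂ (shape k) (ℕP.≮⇒≥ k≮p))))

  left-descending : {l : Fin r → Sym n r} → LeftOK l →
    ∀ {k k'} → toℕ k < toℕ k' → zer ≺ l k' → l k' ≺ l k
  left-descending (p , _ , shape , desc) {k} {k'} k<k' zer≺lk' with toℕ k' <? p
  ... | yes k'<p = desc k k' k<k' k'<p
  ... | no  k'≮p = ⊥-elim (ℤP.<-irrefl refl (subst (zer ≺_) (proj₂ (shape k') (ℕP.≮⇒≥ k'≮p)) zer≺lk'))

  right-nonpos : {g : Fin (n ∸ r) → Sym n r} → RightOK g → ∀ k → g k ⪯ zer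
  right-nonpos (q , _ , shape , _) k with toℕ k <? q
  ... | yes k<q = ℤP.≤-reflexive (cong rank (proj₁ (shape k) k<q))
  ... | no  k≮q = ℤP.<⇒≤ (bar⇒≺zer (proj₂ (shape k) (ℕP.≮⇒≥ k≮q)))

  right-descending : {g : Fin (n ∸ r) → Sym n r} → RightOK g →
    ∀ {k k'} → toℕ k < toℕ k' → g k ≺ zer → g k' ≺ g k
  right-descending (q , _ , shape , desc) {k} {k'} k<k' gk≺zer with toℕ k <? q
  ... | yes k<q = ⊥-elim (ℤP.<-irrefl refl (subst (_≺ zer) (proj₁ (shape k) k<q) gk≺zer))
  ... | no  k≮q = desc k k' (ℕP.≮⇒≥ k≮q) k<k'

  leftOK-⊓ : {l l' : Fin r → Sym n r} → LeftOK l → LeftOK l' → LeftOK (λ k → minS (l k) (l' k))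
  leftOK-⊓ {l} {l'} ok@(p , p≤r , shape , desc) ok'@(p' , _ , shape' , desc') =
    p ℕ.⊓ p' , ℕP.≤-trans (ℕP.m⊓n≤m p p') p≤r , (λ k → tildes k , zeros k) , descending
    where
    tildes : ∀ k → toℕ k < p ℕ.⊓ p' → IsTilde (minS (l k) (l' k))
    tildes k k<p⊓p' = sel-pres minS-sel IsTilde
      (proj₁ (shape k) (ℕP.m<n⊓o⇒m<n p p' k<p⊓p')) (proj₁ (shape' k) (ℕP.m<n⊓o⇒m<o p p' k<p⊓p'))
    zeros : ∀ k → p ℕ.⊓ p' ≤ toℕ k → minS (l k) (l' k) ≡ zer
    zeros k p⊓p'≤k = zer-antisym
      (minS-⪯-zer (Sum.map (proj₂ (shape k)) (proj₂ (shape' k)) (sel-reflect ℕP.⊓-sel (_≤ toℕ k) p⊓p'≤k)))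
      (sel-pres minS-sel (zer ⪯_) (left-nonneg ok k) (left-nonneg ok' k))
    descending : ∀ k k' → toℕ k < toℕ k' → toℕ k' < p ℕ.⊓ p' → minS (l k') (l' k') ≺ minS (l k) (l' k)
    descending k k' k<k' k'<p⊓p' = sel-pres minS-sel (minS (l k') (l' k') ≺_)
      (ℤP.≤-<-trans (minS-⪯ˡ (l k') (l' k')) (desc k k' k<k' (ℕP.m<n⊓o⇒m<n p p' k'<p⊓p')))
      (ℤP.≤-<-trans (minS-⪯ʳ (l k') (l' k')) (desc' k k' k<k' (ℕP.m<n⊓o⇒m<o p p' k'<p⊓p')))

  leftOK-⊔ : {l l' : Fin r → Sym n r} → LeftOK l → LeftOK l' → LeftOK (λ k → maxS (l k) (l' k))
  leftOK-⊔ {l} {l'} ok@(p , p≤r , shape , _) ok'@(p' , p'≤r , shape' , _) =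
    p ℕ.⊔ p' , ℕP.⊔-lub p≤r p'≤r , (λ k → tildes k , zeros k) , descending
    where
    tildes : ∀ k → toℕ k < p ℕ.⊔ p' → IsTilde (maxS (l k) (l' k))
    tildes k k<p⊔p' =
      maxS-tilde (Sum.map (proj₁ (shape k)) (proj₁ (shape' k)) (sel-reflect ℕP.⊔-sel (toℕ k <_) k<p⊔p'))
    zeros : ∀ k → p ℕ.⊔ p' ≤ toℕ k → maxS (l k) (l' k) ≡ zer
    zeros k p⊔p'≤k = sel-pres maxS-sel (_≡ zer)
      (proj₂ (shape k) (ℕP.m⊔n≤o⇒m≤o p p' p⊔p'≤k)) (proj₂ (shape' k) (ℕP.m⊔n≤o⇒n≤o p p' p⊔p'≤k))
    -- Whichever entry the max picks at k' is a tilde, hence already smaller than its own predecessor.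
    descending : ∀ k k' → toℕ k < toℕ k' → toℕ k' < p ℕ.⊔ p' → maxS (l k') (l' k') ≺ maxS (l k) (l' k)
    descending k k' k<k' k'<p⊔p' =
      sel-pres maxS-sel (λ x → zer ≺ x → x ≺ maxS (l k) (l' k))
        (λ pos → ℤP.<-≤-trans (left-descending ok k<k' pos) (⪯-maxSˡ (l k) (l' k)))
        (λ pos → ℤP.<-≤-trans (left-descending ok' k<k' pos) (⪯-maxSʳ (l k) (l' k)))
        (tilde⇒zer≺ (tildes k' k'<p⊔p'))

  rightOK-⊓ : {g g' : Fin (n ∸ r) → Sym n r} → RightOK g → RightOK g' → RightOK (λ k → minS (g k) (g' k))
  rightOK-⊓ {g} {g'} ok@(q , q≤m , shape , _) ok'@(q' , _ , shape' , _) =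
    q ℕ.⊓ q' , ℕP.≤-trans (ℕP.m⊓n≤m q q') q≤m , (λ k → zeros k , bars k) , descending
    where
    zeros : ∀ k → toℕ k < q ℕ.⊓ q' → minS (g k) (g' k) ≡ zer
    zeros k k<q⊓q' = sel-pres minS-sel (_≡ zer)
      (proj₁ (shape k) (ℕP.m<n⊓o⇒m<n q q' k<q⊓q')) (proj₁ (shape' k) (ℕP.m<n⊓o⇒m<o q q' k<q⊓q'))
    bars : ∀ k → q ℕ.⊓ q' ≤ toℕ k → IsBar (minS (g k) (g' k))
    bars k q⊓q'≤k =
      minS-bar (Sum.map (proj₂ (shape k)) (proj₂ (shape' k)) (sel-reflect ℕP.⊓-sel (_≤ toℕ k) q⊓q'≤k))
    -- Whichever entry the min picks at k is a bar, hence already larger than its own successor.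
    descending : ∀ k k' → q ℕ.⊓ q' ≤ toℕ k → toℕ k < toℕ k' → minS (g k') (g' k') ≺ minS (g k) (g' k)
    descending k k' q⊓q'≤k k<k' =
      sel-pres minS-sel (λ x → x ≺ zer → minS (g k') (g' k') ≺ x)
        (λ neg → ℤP.≤-<-trans (minS-⪯ˡ (g k') (g' k')) (right-descending ok k<k' neg))
        (λ neg → ℤP.≤-<-trans (minS-⪯ʳ (g k') (g' k')) (right-descending ok' k<k' neg))
        (bar⇒≺zer (bars k q⊓q'≤k))

  rightOK-⊔ : {g g' : Fin (n ∸ r) → Sym n r} → RightOK g → RightOK g' → RightOK (λ k → maxS (g k) (g' k))
  rightOK-⊔ {g} {g'} ok@(q , q≤m , shape , desc) ok'@(q' , q'≤m , shape' , desc') =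
    q ℕ.⊔ q' , ℕP.⊔-lub q≤m q'≤m , (λ k → zeros k , bars k) , descending
    where
    zeros : ∀ k → toℕ k < q ℕ.⊔ q' → maxS (g k) (g' k) ≡ zer
    zeros k k<q⊔q' = zer-antisym
      (sel-pres maxS-sel (_⪯ zer) (right-nonpos ok k) (right-nonpos ok' k))
      (zer-⪯-maxS (Sum.map (proj₁ (shape k)) (proj₁ (shape' k)) (sel-reflect ℕP.⊔-sel (toℕ k <_) k<q⊔q')))
    bars : ∀ k → q ℕ.⊔ q' ≤ toℕ k → IsBar (maxS (g k) (g' k))
    bars k q⊔q'≤k = sel-pres maxS-sel IsBar
      (proj₂ (shape k) (ℕP.m⊔n≤o⇒m≤o q q' q⊔q'≤k)) (proj₂ (shape' k) (ℕP.m⊔n≤o⇒n≤o q q' q⊔q'≤k))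
    descending : ∀ k k' → q ℕ.⊔ q' ≤ toℕ k → toℕ k < toℕ k' → maxS (g k') (g' k') ≺ maxS (g k) (g' k)
    descending k k' q⊔q'≤k k<k' = sel-pres maxS-sel (_≺ maxS (g k) (g' k))
      (ℤP.<-≤-trans (desc k k' (ℕP.m⊔n≤o⇒m≤o q q' q⊔q'≤k) k<k') (⪯-maxSˡ (g k) (g' k)))
      (ℤP.<-≤-trans (desc' k k' (ℕP.m⊔n≤o⇒n≤o q q' q⊔q'≤k) k<k') (⪯-maxSʳ (g k) (g' k)))

  countNZ-interval : ∀ m (f : Fin m → Sym n r) {a b} → a ≤ b → b ≤ m →
    (∀ k → toℕ k < a → f k ≡ zer) →
    (∀ k → a ≤ toℕ k → toℕ k < b → nzSym (f k) ≡ 1) →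
    (∀ k → b ≤ toℕ k → f k ≡ zer) →
    countNZ m f ≡ b ∸ a
  countNZ-interval zero    f z≤n z≤n _ _ _ = refl
  countNZ-interval (suc m) f {zero} {zero} z≤n z≤n _ _ after =
    cong₂ _+_ (cong nzSym (after F.zero z≤n))
      (countNZ-interval m (λ k → f (F.suc k)) z≤n z≤n (λ _ ()) (λ _ _ ()) (λ k _ → after (F.suc k) z≤n))
  countNZ-interval (suc m) f {zero} {suc b} z≤n (s≤s b≤m) _ inside after =
    cong₂ _+_ (inside F.zero z≤n (s≤s z≤n))
      (countNZ-interval m (λ k → f (F.suc k)) z≤n b≤m (λ _ ())
        (λ k _ k<b → inside (F.suc k) z≤n (s≤s k<b)) (λ k b≤k → after (F.suc k) (s≤s b≤k)))
  countNZ-interval (suc m) f {suc a} {suc b} (s≤s a≤b) (s≤s b≤m) before inside after =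
    cong₂ _+_ (cong nzSym (before F.zero (s≤s z≤n)))
      (countNZ-interval m (λ k → f (F.suc k)) a≤b b≤m (λ k k<a → before (F.suc k) (s≤s k<a))
        (λ k a≤k k<b → inside (F.suc k) (s≤s a≤k) (s≤s k<b)) (λ k b≤k → after (F.suc k) (s≤s b≤k)))

  countNZ-left : {l : Fin r → Sym n r} (ok : LeftOK l) → countNZ r l ≡ proj₁ ok
  countNZ-left (p , p≤r , shape , _) = countNZ-interval r _ z≤n p≤r (λ _ ())
    (λ k _ k<p → nzSym-tilde (proj₁ (shape k) k<p)) (λ k p≤k → proj₂ (shape k) p≤k)

  countNZ-right : {g : Fin (n ∸ r) → Sym n r} (ok : RightOK g) → countNZ (n ∸ r) g ≡ n ∸ r ∸ proj₁ ok
  countNZ-right (q , q≤m , shape , _) = countNZ-interval (n ∸ r) _ q≤m ℕP.≤-refl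
    (λ k k<q → proj₁ (shape k) k<q) (λ k q≤k _ → nzSym-bar (proj₂ (shape k) q≤k))
    (λ k m≤k → ⊥-elim (ℕP.<⇒≱ (FP.toℕ<n k) m≤k))

  nonZeros-InS : {w : Str n r} (ok : InS w) → nonZeros w ≡ proj₁ (proj₁ ok) + (n ∸ r ∸ proj₁ (proj₂ ok))
  nonZeros-InS (lok , rok) = cong₂ _+_ (countNZ-left lok) (countNZ-right rok)

  level-InS : ∀ {d} {w : Str n r} (ok : InS w) → nonZeros w ≡ d →
    proj₁ (proj₁ ok) + (n ∸ r ∸ proj₁ (proj₂ ok)) ≡ d
  level-InS ok = trans (sym (nonZeros-InS ok))

  InSd-⊓ : ∀ {d} {w v : Str n r} → InSd d w → InSd d v → InSd d (w ⊓ v)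
  InSd-⊓ ((lw , rw) , #w) ((lv , rv) , #v) = ok ,
    trans (nonZeros-InS ok) (level-closed ℕP.+-distribˡ-⊓ ℕP.+-distribʳ-⊓
      (proj₁ (proj₂ rw)) (proj₁ (proj₂ rv)) (proj₁ (proj₂ (proj₂ ok)))
      (level-InS (lw , rw) #w) (level-InS (lv , rv) #v))
    where ok = leftOK-⊓ lw lv , rightOK-⊓ rw rv

  InSd-⊔ : ∀ {d} {w v : Str n r} → InSd d w → InSd d v → InSd d (w ⊔ v)
  InSd-⊔ ((lw , rw) , #w) ((lv , rv) , #v) = ok ,
    trans (nonZeros-InS ok) (level-closed ℕP.+-distribˡ-⊔ ℕP.+-distribʳ-⊔
      (proj₁ (proj₂ rw)) (proj₁ (proj₂ rv)) (proj₁ (proj₂ (proj₂ ok)))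
      (level-InS (lw , rw) #w) (level-InS (lv , rv) #v))
    where ok = leftOK-⊔ lw lv , rightOK-⊔ rw rv

mainTheorem2 : (n r d : ℕ) → 1 ≤ r → r ≤ n → 1 ≤ d → d ≤ n →
    (w v : Str n r) → InSd d w → InSd d v →
    InSd d (w ⊓ v) × InSd d (w ⊔ v)
mainTheorem2 _ _ _ _ _ _ _ _ _ w∈S v∈S = InSd-⊓ w∈S v∈S , InSd-⊔ w∈S v∈S
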